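{- Let $k\geq 1$, $n=8k+r$ with $r\in\{5,6,7,8\}$, $G=C(n,\pm\{1,2,3,4\})$, $a\in\mathbb{Z}_n$, and let $A=(\{a,a+1\},\{a+2,a+3,a+4\})$ (indices mod $n$) be an $S$-cluster for some $S\subseteq V(G)$. If $X\subseteq V(G)$ resolves $A$, then $|X|\geq 3$.
   Context: $C(n,\pm\{1,2,3,4\})$ is the graph on $\mathbb{Z}_n$ where distinct $i,j$ are adjacent iff $j-i\equiv\pm s\pmod n$ for some $s\in\{1,2,3,4\}$; $d$ is graph distance, and $r(v|X)=(d(v,x))_{x\in X}$. For $S\subseteq V$, a set $B$ is an $S$-block if $r(a|S)=r(b|S)$ for all $a,b\in B$. A tuple $(A_1,\dots,A_p)$ of $S$-blocks is an $S$-cluster if the $A_i$ are contained in distinct equivalence classes of $u\sim_S v\iff r(u|S)=r(v|S)$. A set $X$ resolves a tuple $(A_1,\dots,A_p)$ if $r(a|X)\neq r(b|X)$ for all distinct $a,b$ in the same $A_j$. -}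

module Defs where

open import Data.Bool using (Bool; true; false; _∧_; _∨_; not; if_then_else_)
open import Data.Nat using (ℕ; zero; suc; _+_; _*_; NonZero)
open import Data.Nat.DivMod using (_%_; m%n<n)
open import Data.Fin using (Fin; toℕ; fromℕ<; _≟_)
open import Data.Fin.Subset using (Subset; _∈_)
open import Data.List using (List; allFin; _∷_; [])
open import Data.Bool.ListAction using (any)
open import Data.List.Relation.Unary.All using (All)
open import Data.List.Relation.Unary.AllPairs using (AllPairs)
open import Data.Product using (_×_)
open import Relation.Nullary using (¬_)
open import Relation.Nullary.Decidable using (⌊_⌋)
open import Relation.Binary.PropositionalEquality using (_≡_; _≢_)

module _ (n : ℕ) .{{_ : NonZero n}} where

  shift : Fin n → ℕ → Fin n
  shift i s = fromℕ< (m%n<n (toℕ i + s) n)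

  diffIs : Fin n → Fin n → ℕ → Bool
  diffIs i j s = ⌊ j ≟ shift i s ⌋

  adj : Fin n → Fin n → Bool
  adj i j = not ⌊ i ≟ j ⌋ ∧
    any (λ s → diffIs i j s ∨ diffIs j i s) (1 ∷ 2 ∷ 3 ∷ 4 ∷ [])

  within : ℕ → Fin n → Fin n → Bool
  within zero u v = ⌊ u ≟ v ⌋
  within (suc t) u v = within t u v ∨ any (λ w → adj u w ∧ within t w v) (allFin n)

  search : ℕ → ℕ → Fin n → Fin n → ℕ
  search zero t u v = t
  search (suc f) t u v = if within t u v then t else search f (suc t) u v

  -- graph distance d(u,v) (the graph is connected with diameter < n, so
  -- the search with fuel n always finds the least such t)
  dist : Fin n → Fin n → ℕ
  dist u v = search n 0 u v

  SameRep : Subset n → Fin n → Fin n → Set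
  SameRep S u v = ∀ x → x ∈ S → dist u x ≡ dist v x

  IsBlock : Subset n → Subset n → Set
  IsBlock S B = ∀ a b → a ∈ B → b ∈ B → SameRep S a b

  DistinctClasses : Subset n → Subset n → Subset n → Set
  DistinctClasses S B C = ∀ a b → a ∈ B → b ∈ C → ¬ SameRep S a b

  IsCluster : Subset n → List (Subset n) → Set
  IsCluster S As = All (IsBlock S) As × AllPairs (DistinctClasses S) As

  Resolves : Subset n → List (Subset n) → Set
  Resolves X As = All (λ A → ∀ a b → a ∈ A → b ∈ A → a ≢ b → ¬ SameRep X a b) As

-- In C(n, ±{1,2,3,4}) a vertex lies within distance t of x iff it lies on the arc of radius 4t
-- around x in ℤ_n.  If x separates a from a+1, then one of a, a+1 is an end of such an arc
-- (radius 4·d(a,x) or 4·d(a+1,x)), and a+2, a+3, a+4 lie all inside it or all just outside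
-- it: for the latter, its complement must not consist of 1, 2 or 3 vertices, which is where
-- n mod 8 ∈ {0,5,6,7} enters.  So x does not separate a+2, a+3, a+4.  These three vertices
-- are pairwise adjacent, so their distances to any landmark take at most two values; a
-- landmark y separating a+2 from a+3 thus leaves a pair unseparated, which needs a third.
module Submission where

open import Defs
open import Data.Bool using (Bool; true; false; T; _∨_)
open import Data.Bool.Properties using (T-∧; T-∨)
open import Data.Nat using (ℕ; zero; suc; _+_; _*_; _∸_; _≤_; _<_; z≤n; s≤s; NonZero; >-nonZero⁻¹; s<s⁻¹)
open import Data.Nat.Properties renaming (_≟_ to _≟ℕ_)
open import Data.Nat.DivMod
open import Data.Nat.Tactic.RingSolver using (solve-∀)
open import Data.Fin using (Fin; toℕ; _≟_)
open import Data.Fin.Properties using (toℕ-fromℕ<; toℕ<n; toℕ-injective; ¬∀⟶∃¬)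
open import Data.Fin.Subset using (Subset; ⁅_⁆; _∪_; _-_; ∣_∣; _∈_)
open import Data.Fin.Subset.Properties using (x∈⁅x⁆; x∈p∪q⁺; x∈p∧x≢y⇒x∈p-y; x∈p⇒∣p-x∣<∣p∣; _∈?_)
open import Data.List using (List; _∷_; []; allFin)
open import Data.List.Membership.Propositional using (find; lose) renaming (_∈_ to _∈ₗ_)
open import Data.List.Membership.Propositional.Properties using (∈-allFin)
open import Data.List.Relation.Unary.All using (_∷_; [])
open import Data.List.Relation.Unary.Any using (here; there)
open import Data.List.Relation.Unary.Any.Properties using (any⁺; any⁻)
open import Data.Product using (Σ; _×_; _,_; proj₂)
open import Data.Sum using (_⊎_; inj₁; inj₂; swap; [_,_]′)
open import Data.Unit using (tt)
open import Data.Empty using (⊥-elim)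
open import Function.Bundles using (Equivalence)
open import Relation.Nullary using (¬_; yes; no)
open import Relation.Nullary.Decidable using (True; toWitness; fromWitness; fromWitnessFalse; _→-dec_)
open import Relation.Binary.Definitions using (tri<; tri≈; tri>)
open import Relation.Binary.PropositionalEquality

module ModularShift (n : ℕ) .{{_ : NonZero n}} where

  infixl 6 _⊕_
  _⊕_ : Fin n → ℕ → Fin n
  u ⊕ s = shift n u s

  toℕ-⊕ : ∀ u s → toℕ (u ⊕ s) ≡ (toℕ u + s) % n
  toℕ-⊕ u s = toℕ-fromℕ< _

  ⊕-fromToℕ : ∀ u s v → (toℕ u + s) % n ≡ toℕ v → u ⊕ s ≡ v
  ⊕-fromToℕ u s v eq = toℕ-injective (trans (toℕ-⊕ u s) eq)

  ⊕-toℕ : ∀ u s v t → u ⊕ s ≡ v ⊕ t → (toℕ u + s) % n ≡ (toℕ v + t) % n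
  ⊕-toℕ u s v t eq = trans (sym (toℕ-⊕ u s)) (trans (cong toℕ eq) (toℕ-⊕ v t))

  toℕ%n≡toℕ : ∀ (u : Fin n) → toℕ u % n ≡ toℕ u
  toℕ%n≡toℕ u = m<n⇒m%n≡m (toℕ<n u)

  [m%n+k]%n≡[m+k]%n : ∀ m k → (m % n + k) % n ≡ (m + k) % n
  [m%n+k]%n≡[m+k]%n m k = begin
    (m % n + k) % n         ≡⟨ %-distribˡ-+ (m % n) k n ⟩
    (m % n % n + k % n) % n ≡⟨ cong (λ z → (z + k % n) % n) (m%n%n≡m%n m n) ⟩
    (m % n + k % n) % n     ≡⟨ %-distribˡ-+ m k n ⟨
    (m + k) % n             ∎
    where open ≡-Reasoning

  -- Adding ū = n ∸ u % n undoes adding u modulo n.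
  +-cancelʳ-% : ∀ p q u → (p + u) % n ≡ (q + u) % n → p % n ≡ q % n
  +-cancelʳ-% p q u eq = begin
    p % n                    ≡⟨ undo p ⟨
    ((p + u) % n + ū) % n    ≡⟨ cong (λ z → (z + ū) % n) eq ⟩
    ((q + u) % n + ū) % n    ≡⟨ undo q ⟩
    q % n                    ∎
    where
    open ≡-Reasoning
    ū = n ∸ u % n
    u+ū : u + ū ≡ suc (u / n) * n
    u+ū = begin
      u + ū                          ≡⟨ cong (_+ ū) (m≡m%n+[m/n]*n u n) ⟩
      u % n + u / n * n + ū          ≡⟨ cong (_+ ū) (+-comm (u % n) (u / n * n)) ⟩
      u / n * n + u % n + ū          ≡⟨ +-assoc (u / n * n) (u % n) ū ⟩
      u / n * n + (u % n + ū)        ≡⟨ cong (u / n * n +_) (m+[n∸m]≡n (m%n≤n u n)) ⟩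
      u / n * n + n                  ≡⟨ +-comm (u / n * n) n ⟩
      suc (u / n) * n                ∎
    undo : ∀ m → ((m + u) % n + ū) % n ≡ m % n
    undo m = begin
      ((m + u) % n + ū) % n    ≡⟨ [m%n+k]%n≡[m+k]%n (m + u) ū ⟩
      (m + u + ū) % n          ≡⟨ cong (_% n) (+-assoc m u ū) ⟩
      (m + (u + ū)) % n        ≡⟨ cong (λ z → (m + z) % n) u+ū ⟩
      (m + suc (u / n) * n) % n ≡⟨ [m+kn]%n≡m%n m (suc (u / n)) n ⟩
      m % n                    ∎

  ⊕-identityʳ : ∀ u → u ⊕ 0 ≡ u
  ⊕-identityʳ u = ⊕-fromToℕ u 0 u (begin
    (toℕ u + 0) % n ≡⟨ cong (_% n) (+-identityʳ (toℕ u)) ⟩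
    toℕ u % n       ≡⟨ toℕ%n≡toℕ u ⟩
    toℕ u           ∎)
    where open ≡-Reasoning

  ⊕-period : ∀ u → u ⊕ n ≡ u
  ⊕-period u = ⊕-fromToℕ u n u (trans ([m+n]%n≡m%n (toℕ u) n) (toℕ%n≡toℕ u))

  ⊕-assoc : ∀ u s t → u ⊕ s ⊕ t ≡ u ⊕ (s + t)
  ⊕-assoc u s t = ⊕-fromToℕ (u ⊕ s) t (u ⊕ (s + t)) (begin
    (toℕ (u ⊕ s) + t) % n      ≡⟨ cong (λ z → (z + t) % n) (toℕ-⊕ u s) ⟩
    ((toℕ u + s) % n + t) % n  ≡⟨ [m%n+k]%n≡[m+k]%n (toℕ u + s) t ⟩
    (toℕ u + s + t) % n        ≡⟨ cong (_% n) (+-assoc (toℕ u) s t) ⟩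
    (toℕ u + (s + t)) % n      ≡⟨ toℕ-⊕ u (s + t) ⟨
    toℕ (u ⊕ (s + t))          ∎)
    where open ≡-Reasoning

  ⊕-cancelʳ : ∀ u v s → u ⊕ s ≡ v ⊕ s → u ≡ v
  ⊕-cancelʳ u v s eq = toℕ-injective (begin
    toℕ u      ≡⟨ toℕ%n≡toℕ u ⟨
    toℕ u % n  ≡⟨ +-cancelʳ-% (toℕ u) (toℕ v) s (⊕-toℕ u s v s eq) ⟩
    toℕ v % n  ≡⟨ toℕ%n≡toℕ v ⟩
    toℕ v      ∎)
    where open ≡-Reasoning

  ⊕-cancelˡ-% : ∀ u s t → u ⊕ s ≡ u ⊕ t → s % n ≡ t % n
  ⊕-cancelˡ-% u s t eq = +-cancelʳ-% s t (toℕ u) (begin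
    (s + toℕ u) % n ≡⟨ cong (_% n) (+-comm s (toℕ u)) ⟩
    (toℕ u + s) % n ≡⟨ ⊕-toℕ u s u t eq ⟩
    (toℕ u + t) % n ≡⟨ cong (_% n) (+-comm (toℕ u) t) ⟩
    (t + toℕ u) % n ∎)
    where open ≡-Reasoning

  ⊕-cancelˡ : ∀ u {s t} → s < n → t < n → u ⊕ s ≡ u ⊕ t → s ≡ t
  ⊕-cancelˡ u {s} {t} s<n t<n eq =
    trans (sym (m<n⇒m%n≡m s<n)) (trans (⊕-cancelˡ-% u s t eq) (m<n⇒m%n≡m t<n))

  ⊕-≢⊕ : ∀ u {s t} → s < n → t < n → s ≢ t → u ⊕ s ≢ u ⊕ t
  ⊕-≢⊕ u s<n t<n s≢t eq = s≢t (⊕-cancelˡ u s<n t<n eq)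

  ⊕-fixed⇒%≡0 : ∀ u c → u ⊕ c ≡ u → c % n ≡ 0
  ⊕-fixed⇒%≡0 u c eq =
    trans (⊕-cancelˡ-% u c 0 (trans eq (sym (⊕-identityʳ u)))) (m<n⇒m%n≡m (>-nonZero⁻¹ n))

  ⊕-reaches : ∀ u v → v ≡ u ⊕ ((n ∸ toℕ u + toℕ v) % n)
  ⊕-reaches u v = sym (⊕-fromToℕ u _ v (begin
    (toℕ u + (n ∸ toℕ u + toℕ v) % n) % n ≡⟨ cong (_% n) (+-comm (toℕ u) _) ⟩
    ((n ∸ toℕ u + toℕ v) % n + toℕ u) % n ≡⟨ [m%n+k]%n≡[m+k]%n (n ∸ toℕ u + toℕ v) (toℕ u) ⟩
    (n ∸ toℕ u + toℕ v + toℕ u) % n       ≡⟨ cong (_% n) (+-assoc (n ∸ toℕ u) (toℕ v) (toℕ u)) ⟩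
    (n ∸ toℕ u + (toℕ v + toℕ u)) % n     ≡⟨ cong (λ z → (n ∸ toℕ u + z) % n) (+-comm (toℕ v) (toℕ u)) ⟩
    (n ∸ toℕ u + (toℕ u + toℕ v)) % n     ≡⟨ cong (_% n) (+-assoc (n ∸ toℕ u) (toℕ u) (toℕ v)) ⟨
    (n ∸ toℕ u + toℕ u + toℕ v) % n       ≡⟨ cong (λ z → (z + toℕ v) % n) (m∸n+n≡m (<⇒≤ (toℕ<n u))) ⟩
    (n + toℕ v) % n                       ≡⟨ cong (_% n) (+-comm n (toℕ v)) ⟩
    (toℕ v + n) % n                       ≡⟨ [m+n]%n≡m%n (toℕ v) n ⟩
    toℕ v % n                             ≡⟨ toℕ%n≡toℕ v ⟩
    toℕ v                                 ∎))
    where open ≡-Reasoning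

module CircularArc (n : ℕ) .{{_ : NonZero n}} where
  open ModularShift n

  Arc : ℕ → Fin n → Fin n → Set
  Arc m u v = Σ ℕ λ e → e ≤ m × (v ≡ u ⊕ e ⊎ u ≡ v ⊕ e)

  arc-mono : ∀ {m m′ u v} → m ≤ m′ → Arc m u v → Arc m′ u v
  arc-mono m≤m′ (e , e≤m , eq) = e , ≤-trans e≤m m≤m′ , eq

  arc-sym : ∀ {m u v} → Arc m u v → Arc m v u
  arc-sym (e , e≤m , inj₁ eq) = e , e≤m , inj₂ eq
  arc-sym (e , e≤m , inj₂ eq) = e , e≤m , inj₁ eq

  arc-0⇒≡ : ∀ {u v} → Arc 0 u v → u ≡ v
  arc-0⇒≡ {u} (zero , _ , inj₁ eq) = sym (trans eq (⊕-identityʳ u))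
  arc-0⇒≡ {v = v} (zero , _ , inj₂ eq) = trans eq (⊕-identityʳ v)

  arc-⊕≤ : ∀ {m} w {s t} → s ≤ t → t ∸ s ≤ m → Arc m (w ⊕ s) (w ⊕ t)
  arc-⊕≤ w {s} {t} s≤t t∸s≤m =
    t ∸ s , t∸s≤m , inj₁ (sym (trans (⊕-assoc w s (t ∸ s)) (cong (w ⊕_) (m+[n∸m]≡n s≤t))))

  arc-⊕ : ∀ {m} w {s t} → s ≤ m → t ≤ m → Arc m (w ⊕ s) (w ⊕ t)
  arc-⊕ w {s} {t} s≤m t≤m with ≤-total s t
  ... | inj₁ s≤t = arc-⊕≤ w s≤t (≤-trans (m∸n≤m t s) t≤m)
  ... | inj₂ t≤s = arc-sym (arc-⊕≤ w t≤s (≤-trans (m∸n≤m s t) s≤m))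

  private
    arc-⊕-meet≤ : ∀ {m} u v {s t} → t ≤ m → s ≤ t → u ⊕ s ≡ v ⊕ t → Arc m u v
    arc-⊕-meet≤ u v {s} {t} t≤m s≤t eq = t ∸ s , ≤-trans (m∸n≤m t s) t≤m ,
      inj₂ (⊕-cancelʳ u (v ⊕ (t ∸ s)) s (begin
        u ⊕ s               ≡⟨ eq ⟩
        v ⊕ t               ≡⟨ cong (v ⊕_) (m∸n+n≡m s≤t) ⟨
        v ⊕ (t ∸ s + s)     ≡⟨ ⊕-assoc v (t ∸ s) s ⟨
        v ⊕ (t ∸ s) ⊕ s     ∎))
      where open ≡-Reasoning

  arc-⊕-meet : ∀ {m} u v {s t} → s ≤ m → t ≤ m → u ⊕ s ≡ v ⊕ t → Arc m u v
  arc-⊕-meet u v {s} {t} s≤m t≤m eq with ≤-total s t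
  ... | inj₁ s≤t = arc-⊕-meet≤ u v t≤m s≤t eq
  ... | inj₂ t≤s = arc-sym (arc-⊕-meet≤ v u s≤m t≤s (sym eq))

  arc-trans : ∀ {p q u w v} → Arc p u w → Arc q w v → Arc (p + q) u v
  arc-trans {p} {q} {u} (s , s≤p , inj₁ w≡u⊕s) (t , t≤q , inj₁ v≡w⊕t) =
    s + t , +-mono-≤ s≤p t≤q , inj₁ (trans v≡w⊕t (trans (cong (_⊕ t) w≡u⊕s) (⊕-assoc u s t)))
  arc-trans {p} {q} {v = v} (s , s≤p , inj₂ u≡w⊕s) (t , t≤q , inj₂ w≡v⊕t) =
    t + s , subst (t + s ≤_) (+-comm q p) (+-mono-≤ t≤q s≤p) ,
    inj₂ (trans u≡w⊕s (trans (cong (_⊕ s) w≡v⊕t) (⊕-assoc v t s)))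
  arc-trans {p} {q} {u} {v = v} (s , s≤p , inj₁ w≡u⊕s) (t , t≤q , inj₂ w≡v⊕t) =
    arc-⊕-meet u v (≤-trans s≤p (m≤m+n p q)) (≤-trans t≤q (m≤n+m q p)) (trans (sym w≡u⊕s) w≡v⊕t)
  arc-trans {p} {q} {w = w} (s , s≤p , inj₂ u≡w⊕s) (t , t≤q , inj₁ v≡w⊕t) =
    subst₂ (Arc (p + q)) (sym u≡w⊕s) (sym v≡w⊕t)
      (arc-⊕ w (≤-trans s≤p (m≤m+n p q)) (≤-trans t≤q (m≤n+m q p)))

  arc-complete : ∀ {m} u v → n ≤ m → Arc m u v
  arc-complete u v n≤m = _ , ≤-trans (<⇒≤ (m%n<n _ n)) n≤m , inj₁ (⊕-reaches u v)

  arc-⊕-around : ∀ {m} x s → n ≤ s + m → s ≤ n + m → Arc m (x ⊕ s) x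
  arc-⊕-around {m} x s n≤s+m s≤n+m with ≤-total s n
  ... | inj₁ s≤n = n ∸ s , m≤n+o⇒m∸n≤o n s n≤s+m , inj₁ (sym (begin
    x ⊕ s ⊕ (n ∸ s)    ≡⟨ ⊕-assoc x s (n ∸ s) ⟩
    x ⊕ (s + (n ∸ s))  ≡⟨ cong (x ⊕_) (m+[n∸m]≡n s≤n) ⟩
    x ⊕ n              ≡⟨ ⊕-period x ⟩
    x                  ∎))
    where open ≡-Reasoning
  ... | inj₂ n≤s = s ∸ n , m≤n+o⇒m∸n≤o s n s≤n+m , inj₂ (begin
    x ⊕ s              ≡⟨ cong (x ⊕_) (m∸n+n≡m n≤s) ⟨
    x ⊕ (s ∸ n + n)    ≡⟨ ⊕-assoc x (s ∸ n) n ⟨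
    x ⊕ (s ∸ n) ⊕ n    ≡⟨ ⊕-period (x ⊕ (s ∸ n)) ⟩
    x ⊕ (s ∸ n)        ∎)
    where open ≡-Reasoning

  ¬arc-⊕ : ∀ {m} x s → m < s → s + m < n → ¬ Arc m (x ⊕ s) x
  ¬arc-⊕ {m} x s m<s s+m<n (e , e≤m , inj₁ x≡x⊕s⊕e) =
    <⇒≢ (<-≤-trans (≤-<-trans z≤n m<s) (m≤m+n s e)) (begin
    0               ≡⟨ ⊕-fixed⇒%≡0 x (s + e) (trans (sym (⊕-assoc x s e)) (sym x≡x⊕s⊕e)) ⟨
    (s + e) % n     ≡⟨ m<n⇒m%n≡m (≤-<-trans (+-monoʳ-≤ s e≤m) s+m<n) ⟩
    s + e           ∎)
    where open ≡-Reasoning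
  ¬arc-⊕ {m} x s m<s s+m<n (e , e≤m , inj₂ x⊕s≡x⊕e) = <⇒≢ (≤-<-trans e≤m m<s)
    (sym (⊕-cancelˡ x (≤-<-trans (m≤m+n s m) s+m<n) (≤-<-trans (≤-trans e≤m (m≤n+m m s)) s+m<n) x⊕s≡x⊕e))

  arc-leave : ∀ {m a x} → Arc m a x → ¬ Arc m (a ⊕ 1) x → a ≡ x ⊕ m
  arc-leave {m} {a} {x} (zero , _ , inj₁ x≡a⊕0) ¬arc with m
  ... | zero = trans (sym (trans x≡a⊕0 (⊕-identityʳ a))) (sym (⊕-identityʳ x))
  ... | suc _ = ⊥-elim (¬arc (1 , s≤s z≤n , inj₂ (cong (_⊕ 1) (sym (trans x≡a⊕0 (⊕-identityʳ a))))))
  arc-leave {a = a} (suc e , e<m , inj₁ x≡a⊕e) ¬arc =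
    ⊥-elim (¬arc (e , <⇒≤ e<m , inj₁ (trans x≡a⊕e (sym (⊕-assoc a 1 e)))))
  arc-leave {m} {x = x} (e , e≤m , inj₂ a≡x⊕e) ¬arc with e <? m
  ... | yes e<m = ⊥-elim (¬arc (suc e , e<m , inj₂ (begin
    _ ⊕ 1        ≡⟨ cong (_⊕ 1) a≡x⊕e ⟩
    x ⊕ e ⊕ 1    ≡⟨ ⊕-assoc x e 1 ⟩
    x ⊕ (e + 1)  ≡⟨ cong (x ⊕_) (+-comm e 1) ⟩
    x ⊕ suc e    ∎)))
    where open ≡-Reasoning
  ... | no e≮m = trans a≡x⊕e (cong (x ⊕_) (≤-antisym e≤m (≮⇒≥ e≮m)))

  arc-enter : ∀ {m a x} → Arc m (a ⊕ 1) x → ¬ Arc m a x → x ≡ a ⊕ suc m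
  arc-enter {m} {a} (e , e≤m , inj₁ x≡a⊕1⊕e) ¬arc with suc e ≤? m
  ... | yes 1+e≤m = ⊥-elim (¬arc (suc e , 1+e≤m , inj₁ (trans x≡a⊕1⊕e (⊕-assoc a 1 e))))
  ... | no 1+e≰m = trans x≡a⊕1⊕e (trans (⊕-assoc a 1 e) (cong (λ k → a ⊕ suc k) (≤-antisym e≤m (≤-pred (≰⇒> 1+e≰m)))))
  arc-enter {m} {a} {x} (zero , _ , inj₂ a⊕1≡x⊕0) ¬arc with m
  ... | zero = sym (trans a⊕1≡x⊕0 (⊕-identityʳ x))
  ... | suc _ = ⊥-elim (¬arc (1 , s≤s z≤n , inj₁ (sym (trans a⊕1≡x⊕0 (⊕-identityʳ x)))))
  arc-enter {m} {a} {x} (suc e , e<m , inj₂ a⊕1≡x⊕1+e) ¬arc =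
    ⊥-elim (¬arc (e , <⇒≤ e<m , inj₂ (⊕-cancelʳ a (x ⊕ e) 1 (begin
      a ⊕ 1        ≡⟨ a⊕1≡x⊕1+e ⟩
      x ⊕ suc e    ≡⟨ cong (x ⊕_) (+-comm 1 e) ⟩
      x ⊕ (e + 1)  ≡⟨ ⊕-assoc x e 1 ⟨
      x ⊕ e ⊕ 1    ∎))))
    where open ≡-Reasoning

  arc-split : ∀ p q {u v} → Arc (p + q) u v → Σ (Fin n) λ w → Arc p u w × Arc q w v
  arc-split p q {u} {v} (e , e≤ , eq) with ≤-total e p
  ... | inj₁ e≤p = v , (e , e≤p , eq) , (0 , z≤n , inj₁ (sym (⊕-identityʳ v)))
  ... | inj₂ p≤e with eq
  ...   | inj₁ v≡u⊕e = u ⊕ p , (p , ≤-refl , inj₁ refl) , (e ∸ p , m≤n+o⇒m∸n≤o e p e≤ , inj₁ (begin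
          v                 ≡⟨ v≡u⊕e ⟩
          u ⊕ e             ≡⟨ cong (u ⊕_) (m+[n∸m]≡n p≤e) ⟨
          u ⊕ (p + (e ∸ p)) ≡⟨ ⊕-assoc u p (e ∸ p) ⟨
          u ⊕ p ⊕ (e ∸ p)   ∎))
    where open ≡-Reasoning
  ...   | inj₂ u≡v⊕e = v ⊕ (e ∸ p) , (p , ≤-refl , inj₂ (begin
          u                 ≡⟨ u≡v⊕e ⟩
          v ⊕ e             ≡⟨ cong (v ⊕_) (m∸n+n≡m p≤e) ⟨
          v ⊕ (e ∸ p + p)   ≡⟨ ⊕-assoc v (e ∸ p) p ⟨
          v ⊕ (e ∸ p) ⊕ p   ∎)) , (e ∸ p , m≤n+o⇒m∸n≤o e p e≤ , inj₂ refl)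
    where open ≡-Reasoning

module Distance (n : ℕ) .{{_ : NonZero n}} where
  open ModularShift n
  open CircularArc n

  Steps : List ℕ
  Steps = 1 ∷ 2 ∷ 3 ∷ 4 ∷ []

  ∈Steps⇒≤4 : ∀ {s} → s ∈ₗ Steps → s ≤ 4
  ∈Steps⇒≤4 (here refl) = s≤s z≤n
  ∈Steps⇒≤4 (there (here refl)) = s≤s (s≤s z≤n)
  ∈Steps⇒≤4 (there (there (here refl))) = s≤s (s≤s (s≤s z≤n))
  ∈Steps⇒≤4 (there (there (there (here refl)))) = ≤-refl

  ≤4⇒∈Steps : ∀ {s} → 1 ≤ s → s ≤ 4 → s ∈ₗ Steps
  ≤4⇒∈Steps {1} _ _ = here refl
  ≤4⇒∈Steps {2} _ _ = there (here refl)
  ≤4⇒∈Steps {3} _ _ = there (there (here refl))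
  ≤4⇒∈Steps {4} _ _ = there (there (there (here refl)))
  ≤4⇒∈Steps {suc (suc (suc (suc (suc _))))} _ (s≤s (s≤s (s≤s (s≤s ()))))

  adj⇒arc : ∀ {u w} → T (adj n u w) → Arc 4 u w
  adj⇒arc {u} {w} u~w with find (any⁻ _ Steps (proj₂ (Equivalence.to T-∧ u~w)))
  ... | s , s∈ , diff = s , ∈Steps⇒≤4 s∈ , offset (Equivalence.to T-∨ diff)
    where
    offset : T (diffIs n u w s) ⊎ T (diffIs n w u s) → w ≡ u ⊕ s ⊎ u ≡ w ⊕ s
    offset (inj₁ d) = inj₁ (toWitness {a? = w ≟ u ⊕ s} d)
    offset (inj₂ d) = inj₂ (toWitness {a? = u ≟ w ⊕ s} d)

  arc⇒adj : ∀ {u w} → Arc 4 u w → u ≢ w → T (adj n u w)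
  arc⇒adj {u} {w} (zero , _ , eq) u≢w = ⊥-elim (u≢w (arc-0⇒≡ (0 , z≤n , eq)))
  arc⇒adj {u} {w} (s@(suc _) , s≤4 , eq) u≢w = Equivalence.from T-∧
    (fromWitnessFalse {a? = u ≟ w} u≢w , any⁺ step (lose (≤4⇒∈Steps (s≤s z≤n) s≤4) (Equivalence.from T-∨ (diff eq))))
    where
    step : ℕ → Bool
    step s = diffIs n u w s ∨ diffIs n w u s
    diff : w ≡ u ⊕ s ⊎ u ≡ w ⊕ s → T (diffIs n u w s) ⊎ T (diffIs n w u s)
    diff (inj₁ e) = inj₁ (fromWitness {a? = w ≟ u ⊕ s} e)
    diff (inj₂ e) = inj₂ (fromWitness {a? = u ≟ w ⊕ s} e)

  within⇒arc : ∀ t {u v} → T (within n t u v) → Arc (t * 4) u v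
  within⇒arc zero {u} {v} u≡v = 0 , z≤n , inj₁ (trans (sym (toWitness {a? = u ≟ v} u≡v)) (sym (⊕-identityʳ u)))
  within⇒arc (suc t) {u} {v} h with Equivalence.to T-∨ h
  ... | inj₁ short = arc-mono (m≤n+m (t * 4) 4) (within⇒arc t short)
  ... | inj₂ step with find (any⁻ _ (allFin n) step)
  ...   | w , _ , u~w∧w→v with Equivalence.to T-∧ u~w∧w→v
  ...     | u~w , w→v = arc-trans (adj⇒arc u~w) (within⇒arc t w→v)

  arc⇒within : ∀ t {u v} → Arc (t * 4) u v → T (within n t u v)
  arc⇒within zero {u} {v} arc = fromWitness {a? = u ≟ v} (arc-0⇒≡ arc)
  arc⇒within (suc t) {u} {v} arc with arc-split 4 (t * 4) arc
  ... | w , u-w , w-v with u ≟ w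
  ...   | yes refl = Equivalence.from T-∨ (inj₁ (arc⇒within t w-v))
  ...   | no u≢w = Equivalence.from T-∨ (inj₂ (any⁺ _ (lose (∈-allFin w)
          (Equivalence.from T-∧ (arc⇒adj u-w u≢w , arc⇒within t w-v)))))

  search-minimal : ∀ f t₀ {u v} t → t₀ ≤ t → t < t₀ + f → T (within n t u v) → search n f t₀ u v ≤ t
  search-minimal zero t₀ t t₀≤t t<t₀ _ = ⊥-elim (<-irrefl refl (≤-<-trans t₀≤t (subst (t <_) (+-identityʳ t₀) t<t₀)))
  search-minimal (suc f) t₀ {u} {v} t t₀≤t t<t₀+f reach with within n t₀ u v in eq
  ... | true = t₀≤t
  ... | false with m≤n⇒m<n∨m≡n t₀≤t
  ...   | inj₁ t₀<t = search-minimal f (suc t₀) t t₀<t (subst (t <_) (+-suc t₀ f) t<t₀+f) reach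
  ...   | inj₂ refl = ⊥-elim (subst T eq reach)

  search-found : ∀ f t₀ u v → T (within n (search n f t₀ u v) u v) ⊎ search n f t₀ u v ≡ t₀ + f
  search-found zero t₀ u v = inj₂ (sym (+-identityʳ t₀))
  search-found (suc f) t₀ u v with within n t₀ u v in eq
  ... | true = inj₁ (subst T (sym eq) tt)
  ... | false with search-found f (suc t₀) u v
  ...   | inj₁ found = inj₁ found
  ...   | inj₂ exhausted = inj₂ (trans exhausted (sym (+-suc t₀ f)))

  search-bounded : ∀ f t₀ u v → search n f t₀ u v ≤ t₀ + f
  search-bounded zero t₀ u v = m≤m+n t₀ 0
  search-bounded (suc f) t₀ u v with within n t₀ u v
  ... | true = m≤m+n t₀ (suc f)
  ... | false = subst (search n f (suc t₀) u v ≤_) (sym (+-suc t₀ f)) (search-bounded f (suc t₀) u v)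

  dist≤⇒arc : ∀ {u v} t → dist n u v ≤ t → Arc (t * 4) u v
  dist≤⇒arc {u} {v} t d≤t with search-found n 0 u v
  ... | inj₁ found = arc-mono (*-monoˡ-≤ 4 d≤t) (within⇒arc (dist n u v) found)
  ... | inj₂ d≡n = arc-complete u v (≤-trans (subst (_≤ t) d≡n d≤t) (m≤m*n t 4))

  arc⇒dist≤ : ∀ {u v} t → Arc (t * 4) u v → dist n u v ≤ t
  arc⇒dist≤ {u} {v} t arc with t <? n
  ... | yes t<n = search-minimal n 0 t z≤n t<n (arc⇒within t arc)
  ... | no t≮n = ≤-trans (search-bounded n 0 u v) (≮⇒≥ t≮n)

  dist-step : ∀ {u w} x → Arc 4 u w → dist n u x ≤ suc (dist n w x)
  dist-step {w = w} x u-w = arc⇒dist≤ (suc (dist n w x)) (arc-trans u-w (dist≤⇒arc (dist n w x) ≤-refl))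

  ¬arc⇒<dist : ∀ {u x} t → ¬ Arc (t * 4) u x → t < dist n u x
  ¬arc⇒<dist t ¬arc = ≰⇒> λ d≤t → ¬arc (dist≤⇒arc t d≤t)

t*4+j+t*4≡t*8+j : ∀ t j → t * 4 + j + t * 4 ≡ t * 8 + j
t*4+j+t*4≡t*8+j = solve-∀

-- The arc of radius 4t has 8t + 1 vertices; gap says its complement never has 1, 2 or 3.
module Separation (n : ℕ) .{{_ : NonZero n}} (4<n : 4 < n)
  (gap : ∀ t → t * 8 + 1 < n → t * 8 + 4 < n) where
  open ModularShift n
  open CircularArc n
  open Distance n

  dist-⊕-leaving : ∀ a x → dist n a x < dist n (a ⊕ 1) x →
    ∀ {i} → 2 ≤ i → i ≤ 4 → dist n (a ⊕ i) x ≡ suc (dist n a x)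
  dist-⊕-leaving a x d<d₁ {i} 2≤i i≤4 =
    ≤-antisym (dist-step x (i , i≤4 , inj₂ refl)) (¬arc⇒<dist t ¬arcᵢ)
    where
    t M : ℕ
    t = dist n a x
    M = t * 4
    ¬arc₁ : ¬ Arc M (a ⊕ 1) x
    ¬arc₁ arc = <⇒≱ d<d₁ (arc⇒dist≤ t arc)
    a≡x⊕M : a ≡ x ⊕ M
    a≡x⊕M = arc-leave (dist≤⇒arc t ≤-refl) ¬arc₁
    a⊕≡ : ∀ j → a ⊕ j ≡ x ⊕ (M + j)
    a⊕≡ j = trans (cong (_⊕ j) a≡x⊕M) (⊕-assoc x M j)
    wide : t * 8 + 1 < n
    wide = subst (_< n) (t*4+j+t*4≡t*8+j t 1) (≰⇒> λ n≤ → ¬arc₁ (subst (λ y → Arc M y x) (sym (a⊕≡ 1))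
      (arc-⊕-around x (M + 1) n≤ (subst (_≤ n + M) (+-comm 1 M) (+-monoˡ-≤ M (≤-<-trans z≤n 4<n))))))
    ¬arcᵢ : ¬ Arc M (a ⊕ i) x
    ¬arcᵢ = subst (λ y → ¬ Arc M y x) (sym (a⊕≡ i))
      (¬arc-⊕ x (M + i) (m<m+n M (<-≤-trans (s≤s z≤n) 2≤i))
        (≤-<-trans (+-monoˡ-≤ M (+-monoʳ-≤ M i≤4)) (subst (_< n) (sym (t*4+j+t*4≡t*8+j t 4)) (gap t wide))))

  dist-⊕-entering : ∀ a x → dist n (a ⊕ 1) x < dist n a x →
    Σ ℕ λ c → ∀ {i} → 2 ≤ i → i ≤ 4 → dist n (a ⊕ i) x ≡ c
  dist-⊕-entering a x d₁<d with dist n (a ⊕ 1) x in d₁≡t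
  ... | zero = 1 , λ {i} 2≤i i≤4 → ≤-antisym
          (subst (λ d → dist n (a ⊕ i) x ≤ suc d) d₁≡t (dist-step x (arc-⊕ a i≤4 (s≤s z≤n))))
          (¬arc⇒<dist 0 λ arc → ⊕-≢⊕ a (≤-<-trans i≤4 4<n) (≤-<-trans (s≤s z≤n) 4<n)
             (≢-sym (<⇒≢ 2≤i)) (trans (arc-0⇒≡ arc) x≡a⊕1))
    where
    x≡a⊕1 : x ≡ a ⊕ 1
    x≡a⊕1 = arc-enter (dist≤⇒arc 0 (≤-reflexive d₁≡t)) (λ arc → <⇒≱ d₁<d (arc⇒dist≤ 0 arc))
  ... | t@(suc _) = t , λ {i} 2≤i i≤4 → ≤-antisym
          (arc⇒dist≤ t (subst (Arc (t * 4) (a ⊕ i)) (sym x≡)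
            (arc-⊕≤ a (i≤1+M i≤4) (m≤n+o⇒m∸n≤o (suc M) i (+-monoˡ-≤ M (<-≤-trans (s≤s z≤n) 2≤i))))))
          (≤-pred (<-≤-trans d₁<d (dist-step x (i , i≤4 , inj₁ refl))))
    where
    M : ℕ
    M = t * 4
    x≡ : x ≡ a ⊕ suc M
    x≡ = arc-enter (dist≤⇒arc t (≤-reflexive d₁≡t)) (λ arc → <⇒≱ d₁<d (arc⇒dist≤ t arc))
    i≤1+M : ∀ {i} → i ≤ 4 → i ≤ suc M
    i≤1+M i≤4 = ≤-trans i≤4 (≤-trans (m≤m+n 4 _) (n≤1+n M))

  dist-⊕-constant : ∀ a x → dist n a x ≢ dist n (a ⊕ 1) x →
    Σ ℕ λ c → ∀ {i} → 2 ≤ i → i ≤ 4 → dist n (a ⊕ i) x ≡ c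
  dist-⊕-constant a x d≢d₁ with <-cmp (dist n a x) (dist n (a ⊕ 1) x)
  ... | tri< d<d₁ _ _ = suc (dist n a x) , dist-⊕-leaving a x d<d₁
  ... | tri≈ _ d≡d₁ _ = ⊥-elim (d≢d₁ d≡d₁)
  ... | tri> _ _ d₁<d = dist-⊕-entering a x d₁<d

mod8-gap : ∀ {r} → 5 ≤ r → r ≤ 8 → ∀ k t → t * 8 + 1 < k * 8 + r → t * 8 + 4 < k * 8 + r
mod8-gap 5≤r r≤8 k zero _ = ≤-trans 5≤r (m≤n+m _ (k * 8))
mod8-gap 5≤r r≤8 zero (suc t) 9+8t<r = ⊥-elim (<⇒≱ (≤-trans (s≤s (m≤m+n 8 _)) 9+8t<r) r≤8)
mod8-gap 5≤r r≤8 (suc k) (suc t) lt = +-monoʳ-< 8 (mod8-gap 5≤r r≤8 k t (+-cancelˡ-< 8 _ _ lt))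

private
  adjacent-squeeze : ∀ {p q r} → p < q → q ≤ suc p → q ≤ suc r → r ≤ suc p → p ≡ r ⊎ q ≡ r
  adjacent-squeeze p<q q≤1+p q≤1+r r≤1+p with m≤n⇒m<n∨m≡n (≤-trans p<q q≤1+r)
  ... | inj₁ 1+p<1+r = inj₂ (trans (≤-antisym q≤1+p p<q) (≤-antisym (s<s⁻¹ 1+p<1+r) r≤1+p))
  ... | inj₂ 1+p≡1+r = inj₁ (suc-injective 1+p≡1+r)

adjacent-values : ∀ {p q r} → p ≤ suc q → q ≤ suc p → p ≤ suc r → r ≤ suc p → q ≤ suc r → r ≤ suc q →
  p ≢ q → p ≡ r ⊎ q ≡ r
adjacent-values {p} {q} p≤1+q q≤1+p p≤1+r r≤1+p q≤1+r r≤1+q p≢q with <-cmp p q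
... | tri< p<q _ _ = adjacent-squeeze p<q q≤1+p q≤1+r r≤1+p
... | tri≈ _ p≡q _ = ⊥-elim (p≢q p≡q)
... | tri> _ _ q<p = swap (adjacent-squeeze q<p p≤1+q p≤1+r r≤1+q)

three-members⇒3≤∣p∣ : ∀ {m} {p : Subset m} {x y z} → x ∈ p → y ∈ p → z ∈ p → x ≢ y → x ≢ z → y ≢ z → 3 ≤ ∣ p ∣
three-members⇒3≤∣p∣ {p = p} {x} {y} {z} x∈p y∈p z∈p x≢y x≢z y≢z =
  ≤-trans (s≤s (s≤s (s≤s z≤n))) (≤-trans (s≤s (s≤s z-out)) (≤-trans (s≤s y-out) x-out))
  where
  x-out : ∣ p - x ∣ < ∣ p ∣
  x-out = x∈p⇒∣p-x∣<∣p∣ x∈p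
  y-out : ∣ p - x - y ∣ < ∣ p - x ∣
  y-out = x∈p⇒∣p-x∣<∣p∣ (x∈p∧x≢y⇒x∈p-y y∈p (≢-sym x≢y))
  z-out : ∣ p - x - y - z ∣ < ∣ p - x - y ∣
  z-out = x∈p⇒∣p-x∣<∣p∣ (x∈p∧x≢y⇒x∈p-y (x∈p∧x≢y⇒x∈p-y z∈p (≢-sym x≢z)) (≢-sym y≢z))

separator : ∀ {n} .{{_ : NonZero n}} {X : Subset n} {u v} → ¬ SameRep n X u v →
  Σ (Fin n) λ x → x ∈ X × dist n u x ≢ dist n v x
separator {n} {X = X} {u} {v} ¬same
  with ¬∀⟶∃¬ n _ (λ x → (x ∈? X) →-dec (dist n u x ≟ℕ dist n v x)) ¬same
... | x , ¬sep with x ∈? X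
...   | yes x∈X = x , x∈X , λ eq → ¬sep (λ _ → eq)
...   | no x∉X = ⊥-elim (¬sep (λ x∈X → ⊥-elim (x∉X x∈X)))

module Landmarks (n : ℕ) .{{_ : NonZero n}} (4<n : 4 < n) (gap : ∀ t → t * 8 + 1 < n → t * 8 + 4 < n) where
  open ModularShift n
  open CircularArc n
  open Distance n
  open Separation n 4<n gap

  three-landmarks : ∀ a {X} → ¬ SameRep n X a (a ⊕ 1) →
    ¬ SameRep n X (a ⊕ 2) (a ⊕ 3) → ¬ SameRep n X (a ⊕ 2) (a ⊕ 4) → ¬ SameRep n X (a ⊕ 3) (a ⊕ 4) →
    3 ≤ ∣ X ∣
  three-landmarks a {X} sep₀₁ sep₂₃ sep₂₄ sep₃₄ with separator sep₀₁ | separator sep₂₃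
  ... | x , x∈X , x-sep | y , y∈X , y-sep with dist-⊕-constant a x x-sep
  ...   | c , flat = [ third sep₂₄ (x-flat 2 4) , third sep₃₄ (x-flat 3 4) ]′
    (adjacent-values (y-near 2 3) (y-near 3 2) (y-near 2 4) (y-near 4 2) (y-near 3 4) (y-near 4 3) y-sep)
    where
    x-flat : ∀ i j {2≤i : True (2 ≤? i)} {i≤4 : True (i ≤? 4)} {2≤j : True (2 ≤? j)} {j≤4 : True (j ≤? 4)} →
      dist n (a ⊕ i) x ≡ dist n (a ⊕ j) x
    x-flat i j {2≤i} {i≤4} {2≤j} {j≤4} =
      trans (flat (toWitness 2≤i) (toWitness i≤4)) (sym (flat (toWitness 2≤j) (toWitness j≤4)))
    y-near : ∀ i j {i≤4 : True (i ≤? 4)} {j≤4 : True (j ≤? 4)} → dist n (a ⊕ i) y ≤ suc (dist n (a ⊕ j) y)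
    y-near i j {i≤4} {j≤4} = dist-step y (arc-⊕ a (toWitness i≤4) (toWitness j≤4))
    third : ∀ {i j} → ¬ SameRep n X (a ⊕ i) (a ⊕ j) →
      dist n (a ⊕ i) x ≡ dist n (a ⊕ j) x → dist n (a ⊕ i) y ≡ dist n (a ⊕ j) y → 3 ≤ ∣ X ∣
    third sep x-tie y-tie with separator sep
    ... | z , z∈X , z-sep = three-members⇒3≤∣p∣ x∈X y∈X z∈X
      (λ { refl → y-sep (x-flat 2 3) })
      (λ { refl → z-sep x-tie })
      (λ { refl → z-sep y-tie })

lemma3p7 : (k r n : ℕ) → .{{_ : NonZero n}} → 1 ≤ k → 5 ≤ r → r ≤ 8 → n ≡ 8 * k + r →
    (a : Fin n) (S X : Subset n) →
    IsCluster n S ((⁅ a ⁆ ∪ ⁅ shift n a 1 ⁆) ∷ (⁅ shift n a 2 ⁆ ∪ ⁅ shift n a 3 ⁆ ∪ ⁅ shift n a 4 ⁆) ∷ []) →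
    Resolves n X ((⁅ a ⁆ ∪ ⁅ shift n a 1 ⁆) ∷ (⁅ shift n a 2 ⁆ ∪ ⁅ shift n a 3 ⁆ ∪ ⁅ shift n a 4 ⁆) ∷ []) →
    3 ≤ ∣ X ∣
lemma3p7 k r n _ 5≤r r≤8 n≡8k+r a S X _ (res₀₁ ∷ res₂₃₄ ∷ []) =
  three-landmarks a
    (res₀₁ _ _ (x∈p∪q⁺ (inj₁ (x∈⁅x⁆ a))) (x∈p∪q⁺ (inj₂ (x∈⁅x⁆ (a ⊕ 1)))) a≢a⊕1)
    (res₂₃₄ _ _ ∈₂ ∈₃ (distinct 2 3))
    (res₂₃₄ _ _ ∈₂ ∈₄ (distinct 2 4))
    (res₂₃₄ _ _ ∈₃ ∈₄ (distinct 3 4))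
  where
  4<n : 4 < n
  4<n = subst (4 <_) (sym n≡8k+r) (≤-trans 5≤r (m≤n+m r (8 * k)))
  gap : ∀ t → t * 8 + 1 < n → t * 8 + 4 < n
  gap t = subst (λ m → t * 8 + 1 < m → t * 8 + 4 < m) (sym (trans n≡8k+r (cong (_+ r) (*-comm 8 k))))
    (mod8-gap 5≤r r≤8 k t)
  open ModularShift n
  open Landmarks n 4<n gap
  distinct : ∀ i j {i<j : True (i <? j)} {j≤4 : True (j ≤? 4)} → a ⊕ i ≢ a ⊕ j
  distinct i j {i<j} {j≤4} = ⊕-≢⊕ a (<-trans (toWitness i<j) j<n) j<n (<⇒≢ (toWitness i<j))
    where
    j<n : j < n
    j<n = ≤-<-trans (toWitness j≤4) 4<n
  a≢a⊕1 : a ≢ a ⊕ 1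
  a≢a⊕1 = subst (_≢ a ⊕ 1) (⊕-identityʳ a) (distinct 0 1)
  B : Subset n
  B = ⁅ a ⊕ 2 ⁆ ∪ ⁅ a ⊕ 3 ⁆ ∪ ⁅ a ⊕ 4 ⁆
  ∈₂ : a ⊕ 2 ∈ B
  ∈₃ : a ⊕ 3 ∈ B
  ∈₄ : a ⊕ 4 ∈ B
  ∈₂ = x∈p∪q⁺ (inj₁ (x∈⁅x⁆ (a ⊕ 2)))
  ∈₃ = x∈p∪q⁺ (inj₂ (x∈p∪q⁺ (inj₁ (x∈⁅x⁆ (a ⊕ 3)))))
  ∈₄ = x∈p∪q⁺ (inj₂ (x∈p∪q⁺ (inj₂ (x∈⁅x⁆ (a ⊕ 4)))))
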